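{- If $c=(c_1,\dots,c_n)$ is a representative of a quiddity cycle, then either $c$ is one of \[(0,0),\ (1,1,1),\ (1,2,1,2),\ (2,1,2,1),\ (2,1,3,1,2),\] or one of the sequences $(c_2,\dots,c_{n-1})$ or $(c_{n-1},\dots,c_2)$ contains one of \[(1,2,2),(1,2,3),(1,2,4),(2,1,3),(2,1,4),(2,1,5),(3,1,4),(3,1,5),(1,3,1,3).\]
   Context: A finite sequence is an element of $\mathbb{N}_0^n$ for some $n\ge1$. $(\!(c_1,\dots,c_n)\!)$ denotes the orbit of $(c_1,\dots,c_n)$ under the dihedral group acting on positions (rotations and reversal); its elements are called representatives. Quiddity cycles form the smallest set $\mathcal{A}$ of such orbits containing $(\!(0,0)\!)$ and such that $(\!(c_1,\dots,c_n)\!)\in\mathcal{A}$ (any representative) implies $(\!(c_1+1,1,c_2+1,c_3,\dots,c_n)\!)\in\mathcal{A}$. A finite sequence $(a_1,\dots,a_r)$ contains $(d_1,\dots,d_m)$ if there is $k\ge0$ with $k+m\le r$ and $a_{k+i}=d_i$ for $i=1,\dots,m$ (consecutive subsequence, no wrap-around). -}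

module Defs where

open import Data.Nat using (ℕ; suc)
open import Data.List using (List; []; _∷_; _++_; [_]; reverse)
open import Data.Product using (∃; ∃-syntax; _×_)
open import Relation.Binary.PropositionalEquality using (_≡_)

-- A list lies in some orbit of 𝒜 iff it is derivable here: the set of
-- representatives is the smallest set containing (0,0), closed under the
-- dihedral action (rotation, reversal), and closed under the step
-- (c1,c2,...,cn) ↦ (c1+1,1,c2+1,c3,...,cn) applied to any representative.
data IsQuiddity : List ℕ → Set where
  q-base : IsQuiddity (0 ∷ 0 ∷ [])
  q-rot  : ∀ {x xs} → IsQuiddity (x ∷ xs) → IsQuiddity (xs ++ [ x ])
  q-rev  : ∀ {xs} → IsQuiddity xs → IsQuiddity (reverse xs)
  q-step : ∀ {a b xs} → IsQuiddity (a ∷ b ∷ xs) →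
           IsQuiddity (suc a ∷ 1 ∷ suc b ∷ xs)

dropLast : List ℕ → List ℕ
dropLast []           = []
dropLast (x ∷ [])     = []
dropLast (x ∷ y ∷ xs) = x ∷ dropLast (y ∷ xs)

middle : List ℕ → List ℕ
middle []       = []
middle (x ∷ xs) = dropLast xs

Contains : List ℕ → List ℕ → Set
Contains a d = ∃[ pre ] ∃[ suf ] (pre ++ d ++ suf ≡ a)

data Pattern : List ℕ → Set where
  p122  : Pattern (1 ∷ 2 ∷ 2 ∷ [])
  p123  : Pattern (1 ∷ 2 ∷ 3 ∷ [])
  p124  : Pattern (1 ∷ 2 ∷ 4 ∷ [])
  p213  : Pattern (2 ∷ 1 ∷ 3 ∷ [])
  p214  : Pattern (2 ∷ 1 ∷ 4 ∷ [])
  p215  : Pattern (2 ∷ 1 ∷ 5 ∷ [])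
  p314  : Pattern (3 ∷ 1 ∷ 4 ∷ [])
  p315  : Pattern (3 ∷ 1 ∷ 5 ∷ [])
  p1313 : Pattern (1 ∷ 3 ∷ 1 ∷ 3 ∷ [])

data Exceptional : List ℕ → Set where
  e00    : Exceptional (0 ∷ 0 ∷ [])
  e111   : Exceptional (1 ∷ 1 ∷ 1 ∷ [])
  e1212  : Exceptional (1 ∷ 2 ∷ 1 ∷ 2 ∷ [])
  e2121  : Exceptional (2 ∷ 1 ∷ 2 ∷ 1 ∷ [])
  e21312 : Exceptional (2 ∷ 1 ∷ 3 ∷ 1 ∷ 2 ∷ [])

-- Every quiddity cycle other than (0,0) is obtained by gluing two smaller ones
-- to two sides of a new triangle, and the middle of the glued cycle contains the
-- middles of both parts.  So a pattern found in either part survives the gluing,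
-- and the only case left, both parts exceptional, is 25 explicit computations.
-- To reach the gluing decomposition, ears are first allowed at every position of
-- a cycle; the cycles generated that way are closed under rotation and reversal.
module Submission where

open import Defs
open import Data.Nat using (ℕ; zero; suc; _+_; _≟_)
open import Data.Nat.Properties using (+-suc)
open import Data.List using (List; []; _∷_; _++_; [_]; reverse; length)
open import Data.List.Properties using (++-assoc; reverse-++; ≡-dec)
open import Data.List.Relation.Binary.Infix.Heterogeneous using (Infix; MkView; toView)
open import Data.List.Relation.Binary.Infix.Heterogeneous.Properties using (infix?)
open import Data.List.Relation.Binary.Pointwise using (Pointwise-≡⇒≡)
open import Data.List.Relation.Unary.Any using (Any; any?; satisfied)
open import Data.Maybe as Maybe using (Maybe; is-just; to-witness-T; _<∣>_)
open import Data.Bool using (T)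
open import Data.Product as Product using (∃; ∃-syntax; ∃₂; _×_; _,_)
open import Data.Sum as Sum using (_⊎_; inj₁; inj₂)
open import Relation.Nullary.Decidable using (Dec; _⊎-dec_; dec⇒maybe)
open import Relation.Binary.PropositionalEquality
  using (_≡_; refl; sym; trans; cong; subst; module ≡-Reasoning)

sucHead : List ℕ → List ℕ
sucHead []       = []
sucHead (x ∷ xs) = suc x ∷ xs

sucLast : List ℕ → List ℕ
sucLast []           = []
sucLast (x ∷ [])     = suc x ∷ []
sucLast (x ∷ y ∷ xs) = x ∷ sucLast (y ∷ xs)

fuse : List ℕ → List ℕ → List ℕ
fuse []            ys       = ys
fuse (x ∷ [])      []       = x ∷ []
fuse (x ∷ [])      (y ∷ ys) = suc (x + y) ∷ ys
fuse (x ∷ x′ ∷ xs) ys       = x ∷ fuse (x′ ∷ xs) ys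

-- Triangulated polygons with quiddities l and r attached to two sides of a new
-- triangle; the first entry of l, the last of r and the shared vertex gain 1.
-- The quiddity (0,0) stands for a single edge.
glue : List ℕ → List ℕ → List ℕ
glue l r = sucHead (fuse l (sucLast r))

-- An ear between positions i and i + 1, counting from 0; the identity if i + 1 is out of range.
insertEar : ℕ → List ℕ → List ℕ
insertEar _       []           = []
insertEar _       (x ∷ [])     = x ∷ []
insertEar zero    (x ∷ y ∷ xs) = suc x ∷ 1 ∷ suc y ∷ xs
insertEar (suc i) (x ∷ y ∷ xs) = x ∷ insertEar i (y ∷ xs)

data GlueGenerated : List ℕ → Set where
  edge     : GlueGenerated (0 ∷ 0 ∷ [])
  triangle : ∀ {l r} → GlueGenerated l → GlueGenerated r → GlueGenerated (glue l r)

data EarGenerated : List ℕ → Set where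
  edge : EarGenerated (0 ∷ 0 ∷ [])
  ear  : ∀ p a b s → EarGenerated (p ++ a ∷ b ∷ s) →
         EarGenerated (p ++ suc a ∷ 1 ∷ suc b ∷ s)

insertEar-sucHead : ∀ i xs → insertEar i (sucHead xs) ≡ sucHead (insertEar i xs)
insertEar-sucHead i       []           = refl
insertEar-sucHead i       (x ∷ [])     = refl
insertEar-sucHead zero    (x ∷ y ∷ xs) = refl
insertEar-sucHead (suc i) (x ∷ y ∷ xs) = refl

insertEar-sucLast : ∀ i xs → insertEar i (sucLast xs) ≡ sucLast (insertEar i xs)
insertEar-sucLast i             []               = refl
insertEar-sucLast i             (x ∷ [])         = refl
insertEar-sucLast zero          (x ∷ y ∷ [])     = refl
insertEar-sucLast zero          (x ∷ y ∷ z ∷ zs) = refl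
insertEar-sucLast (suc i)       (x ∷ y ∷ [])     = refl
insertEar-sucLast (suc zero)    (x ∷ y ∷ z ∷ zs) =
  cong (x ∷_) (insertEar-sucLast zero (y ∷ z ∷ zs))
insertEar-sucLast (suc (suc i)) (x ∷ y ∷ z ∷ zs) =
  cong (x ∷_) (insertEar-sucLast (suc i) (y ∷ z ∷ zs))

EarInLeft EarInRight : ℕ → (List ℕ → List ℕ → List ℕ) → List ℕ → List ℕ → Set
EarInLeft  i f l r = insertEar i (f l r) ≡ f (insertEar i l) r
EarInRight i f l r = ∃[ j ] insertEar i (f l r) ≡ f l (insertEar j r)

insertEar-fuse : ∀ i l r → EarInLeft i fuse l r ⊎ EarInRight i fuse l r
insertEar-fuse i             []                 r            = inj₂ (i , refl)
insertEar-fuse i             (x ∷ [])           []           = inj₂ (i , refl)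
insertEar-fuse i             (x ∷ [])           (y ∷ [])     = inj₂ (i , refl)
insertEar-fuse zero          (x ∷ [])           (y ∷ z ∷ zs) =
  inj₂ (zero , cong (λ w → suc w ∷ 1 ∷ suc z ∷ zs) (sym (+-suc x y)))
insertEar-fuse (suc i)       (x ∷ [])           (y ∷ z ∷ zs) = inj₂ (suc i , refl)
insertEar-fuse zero          (x ∷ x′ ∷ [])      []           = inj₁ refl
insertEar-fuse zero          (x ∷ x′ ∷ [])      (y ∷ ys)     = inj₁ refl
insertEar-fuse zero          (x ∷ x′ ∷ x″ ∷ xs) r            = inj₁ refl
insertEar-fuse (suc i)       (x ∷ x′ ∷ [])      []           = inj₁ refl
insertEar-fuse (suc i)       (x ∷ x′ ∷ [])      (y ∷ ys)     =
  Sum.map (cong (x ∷_)) (Product.map₂ (cong (x ∷_))) (insertEar-fuse i (x′ ∷ []) (y ∷ ys))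
insertEar-fuse (suc zero)    (x ∷ x′ ∷ x″ ∷ xs) r            =
  Sum.map (cong (x ∷_)) (Product.map₂ (cong (x ∷_))) (insertEar-fuse zero (x′ ∷ x″ ∷ xs) r)
insertEar-fuse (suc (suc i)) (x ∷ x′ ∷ x″ ∷ xs) r            =
  Sum.map (cong (x ∷_)) (Product.map₂ (cong (x ∷_))) (insertEar-fuse (suc i) (x′ ∷ x″ ∷ xs) r)

insertEar-glue : ∀ i l r → EarInLeft i glue l r ⊎ EarInRight i glue l r
insertEar-glue i l r = Sum.map inLeft inRight (insertEar-fuse i l (sucLast r))
  where
  open ≡-Reasoning
  inLeft : EarInLeft i fuse l (sucLast r) → EarInLeft i glue l r
  inLeft eq = trans (insertEar-sucHead i (fuse l (sucLast r))) (cong sucHead eq)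
  inRight : EarInRight i fuse l (sucLast r) → EarInRight i glue l r
  inRight (j , eq) = j , (begin
    insertEar i (sucHead (fuse l (sucLast r)))  ≡⟨ insertEar-sucHead i (fuse l (sucLast r)) ⟩
    sucHead (insertEar i (fuse l (sucLast r)))  ≡⟨ cong sucHead eq ⟩
    sucHead (fuse l (insertEar j (sucLast r)))  ≡⟨ cong (λ z → sucHead (fuse l z)) (insertEar-sucLast j r) ⟩
    sucHead (fuse l (sucLast (insertEar j r)))  ∎)

GlueGenerated-insertEar : ∀ {c} → GlueGenerated c → ∀ i → GlueGenerated (insertEar i c)
GlueGenerated-insertEar edge zero    = triangle edge edge
GlueGenerated-insertEar edge (suc i) = edge
GlueGenerated-insertEar (triangle {l} {r} gl gr) i with insertEar-glue i l r
... | inj₁ eq       = subst GlueGenerated (sym eq) (triangle (GlueGenerated-insertEar gl i) gr)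
... | inj₂ (j , eq) = subst GlueGenerated (sym eq) (triangle gl (GlueGenerated-insertEar gr j))

insertEar-length : ∀ p a b s →
  insertEar (length p) (p ++ a ∷ b ∷ s) ≡ p ++ suc a ∷ 1 ∷ suc b ∷ s
insertEar-length []          a b s = refl
insertEar-length (x ∷ [])    a b s = refl
insertEar-length (x ∷ y ∷ p) a b s = cong (x ∷_) (insertEar-length (y ∷ p) a b s)

EarGenerated⇒GlueGenerated : ∀ {c} → EarGenerated c → GlueGenerated c
EarGenerated⇒GlueGenerated edge            = edge
EarGenerated⇒GlueGenerated (ear p a b s e) =
  subst GlueGenerated (insertEar-length p a b s)
    (GlueGenerated-insertEar (EarGenerated⇒GlueGenerated e) (length p))

reverse-++-++ : ∀ {A : Set} (xs ys zs : List A) →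
  reverse (xs ++ ys ++ zs) ≡ reverse zs ++ reverse ys ++ reverse xs
reverse-++-++ xs ys zs = begin
  reverse (xs ++ ys ++ zs)                 ≡⟨ reverse-++ xs (ys ++ zs) ⟩
  reverse (ys ++ zs) ++ reverse xs         ≡⟨ cong (_++ reverse xs) (reverse-++ ys zs) ⟩
  (reverse zs ++ reverse ys) ++ reverse xs ≡⟨ ++-assoc (reverse zs) (reverse ys) (reverse xs) ⟩
  reverse zs ++ reverse ys ++ reverse xs   ∎
  where open ≡-Reasoning

-- An ear at (p, a, b, s) is an ear at (reverse s, b, a, reverse p) of the reversal.
EarGenerated-reverse : ∀ {c} → EarGenerated c → EarGenerated (reverse c)
EarGenerated-reverse edge            = edge
EarGenerated-reverse (ear p a b s e) =
  subst EarGenerated (sym (reverse-++-++ p (suc a ∷ 1 ∷ suc b ∷ []) s))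
    (ear (reverse s) b a (reverse p)
      (subst EarGenerated (reverse-++-++ p (a ∷ b ∷ []) s) (EarGenerated-reverse e)))

rotate : List ℕ → List ℕ
rotate []       = []
rotate (x ∷ xs) = xs ++ [ x ]

-- The ear across the seam between the last and the first position.
wrapEar : List ℕ → List ℕ
wrapEar c = 1 ∷ sucHead (sucLast c)

sucLast-++ : ∀ xs y ys → sucLast (xs ++ y ∷ ys) ≡ xs ++ sucLast (y ∷ ys)
sucLast-++ []            y ys = refl
sucLast-++ (x ∷ [])      y ys = refl
sucLast-++ (x ∷ x′ ∷ xs) y ys = cong (x ∷_) (sucLast-++ (x′ ∷ xs) y ys)

sucLast-ear : ∀ p a b s → ∃₂ λ b′ s′ →
  sucLast (p ++ a ∷ b ∷ s) ≡ p ++ a ∷ b′ ∷ s′ ×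
  sucLast (p ++ suc a ∷ 1 ∷ suc b ∷ s) ≡ p ++ suc a ∷ 1 ∷ suc b′ ∷ s′
sucLast-ear p a b []      = suc b , [] , sucLast-++ p a _ , sucLast-++ p (suc a) _
sucLast-ear p a b (x ∷ s) = b , sucLast (x ∷ s) , sucLast-++ p a _ , sucLast-++ p (suc a) _

EarGenerated-ear-sucHead : ∀ x p a b s →
  EarGenerated (x ∷ sucHead (p ++ a ∷ b ∷ s)) →
  EarGenerated (x ∷ sucHead (p ++ suc a ∷ 1 ∷ suc b ∷ s))
EarGenerated-ear-sucHead x []      a b s = ear (x ∷ []) (suc a) b s
EarGenerated-ear-sucHead x (y ∷ p) a b s = ear (x ∷ suc y ∷ p) a b s

EarGenerated-wrapEar : ∀ {c} → EarGenerated c → EarGenerated (wrapEar c)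
EarGenerated-wrapEar edge = ear [] 0 0 [] edge
EarGenerated-wrapEar (ear p a b s e)
  with b′ , s′ , before , after ← sucLast-ear p a b s =
  subst (λ z → EarGenerated (1 ∷ sucHead z)) (sym after)
    (EarGenerated-ear-sucHead 1 p a b′ s′
      (subst (λ z → EarGenerated (1 ∷ sucHead z)) before (EarGenerated-wrapEar e)))

EarGenerated-rotate : ∀ {c} → EarGenerated c → EarGenerated (rotate c)
EarGenerated-rotate edge                  = edge
EarGenerated-rotate (ear [] a b s e)      =
  subst (λ z → EarGenerated (1 ∷ sucHead z)) (sucLast-++ (b ∷ s) a [])
    (EarGenerated-wrapEar (EarGenerated-rotate e))
EarGenerated-rotate (ear (x ∷ p) a b s e) =
  subst EarGenerated (sym (++-assoc p (suc a ∷ 1 ∷ suc b ∷ s) [ x ]))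
    (ear p a b (s ++ [ x ])
      (subst EarGenerated (++-assoc p (a ∷ b ∷ s) [ x ]) (EarGenerated-rotate e)))

IsQuiddity⇒EarGenerated : ∀ {c} → IsQuiddity c → EarGenerated c
IsQuiddity⇒EarGenerated q-base                  = edge
IsQuiddity⇒EarGenerated (q-rot q)               = EarGenerated-rotate (IsQuiddity⇒EarGenerated q)
IsQuiddity⇒EarGenerated (q-rev q)               = EarGenerated-reverse (IsQuiddity⇒EarGenerated q)
IsQuiddity⇒EarGenerated (q-step {a} {b} {xs} q) = ear [] a b xs (IsQuiddity⇒EarGenerated q)

GlueGenerated-∷∷ : ∀ {c} → GlueGenerated c → ∃[ a ] ∃[ b ] ∃[ rest ] c ≡ a ∷ b ∷ rest
GlueGenerated-∷∷ edge = 0 , 0 , [] , refl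
GlueGenerated-∷∷ (triangle gl gr) with GlueGenerated-∷∷ gl | GlueGenerated-∷∷ gr
... | a , b , []     , refl | c , d , rs , refl = _ , _ , _ , refl
... | a , b , x ∷ ls , refl | c , d , rs , refl = _ , _ , _ , refl

sucLast-∷ : ∀ x xs → ∃₂ λ x′ xs′ → sucLast (x ∷ xs) ≡ x′ ∷ xs′
sucLast-∷ x []       = suc x , [] , refl
sucLast-∷ x (y ∷ xs) = x , sucLast (y ∷ xs) , refl

dropLast-sucLast : ∀ xs → dropLast (sucLast xs) ≡ dropLast xs
dropLast-sucLast []               = refl
dropLast-sucLast (x ∷ [])         = refl
dropLast-sucLast (x ∷ y ∷ [])     = refl
dropLast-sucLast (x ∷ y ∷ z ∷ zs) = cong (x ∷_) (dropLast-sucLast (y ∷ z ∷ zs))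

dropLast-fuse : ∀ x xs y z zs → ∃[ m ]
  dropLast (fuse (x ∷ xs) (y ∷ z ∷ zs)) ≡ dropLast (x ∷ xs) ++ m ∷ dropLast (z ∷ zs)
dropLast-fuse x []             y z zs = suc (x + y) , refl
dropLast-fuse x (x′ ∷ [])      y z zs = Product.map₂ (cong (x ∷_)) (dropLast-fuse x′ [] y z zs)
dropLast-fuse x (x′ ∷ x″ ∷ xs) y z zs = Product.map₂ (cong (x ∷_)) (dropLast-fuse x′ (x″ ∷ xs) y z zs)

middle-glue : ∀ a b ls c d rs → ∃[ m ]
  middle (glue (a ∷ b ∷ ls) (c ∷ d ∷ rs)) ≡ middle (a ∷ b ∷ ls) ++ m ∷ middle (c ∷ d ∷ rs)
middle-glue a b ls c d rs
  with d′ , rs′ , eq ← sucLast-∷ d rs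
  with m , split ← dropLast-fuse b ls c d′ rs′ = m , (begin
  dropLast (fuse (b ∷ ls) (c ∷ sucLast (d ∷ rs)))  ≡⟨ cong (λ z → dropLast (fuse (b ∷ ls) (c ∷ z))) eq ⟩
  dropLast (fuse (b ∷ ls) (c ∷ d′ ∷ rs′))          ≡⟨ split ⟩
  dropLast (b ∷ ls) ++ m ∷ dropLast (d′ ∷ rs′)     ≡⟨ cong (λ z → dropLast (b ∷ ls) ++ m ∷ dropLast z) (sym eq) ⟩
  dropLast (b ∷ ls) ++ m ∷ dropLast (sucLast (d ∷ rs))
    ≡⟨ cong (λ z → dropLast (b ∷ ls) ++ m ∷ z) (dropLast-sucLast (d ∷ rs)) ⟩
  dropLast (b ∷ ls) ++ m ∷ dropLast (d ∷ rs)       ∎)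
  where open ≡-Reasoning

ContainsPattern : List ℕ → Set
ContainsPattern xs = ∃[ d ] (Pattern d × (Contains xs d ⊎ Contains (reverse xs) d))

ExceptionalOrPattern : List ℕ → Set
ExceptionalOrPattern c = Exceptional c ⊎ ContainsPattern (middle c)

Contains-++ˡ : ∀ {xs d} ys → Contains xs d → Contains (xs ++ ys) d
Contains-++ˡ {xs} {d} ys (pre , suf , eq) = pre , suf ++ ys , (begin
  pre ++ d ++ suf ++ ys    ≡⟨ cong (pre ++_) (++-assoc d suf ys) ⟨
  pre ++ (d ++ suf) ++ ys  ≡⟨ ++-assoc pre (d ++ suf) ys ⟨
  (pre ++ d ++ suf) ++ ys  ≡⟨ cong (_++ ys) eq ⟩
  xs ++ ys                 ∎)
  where open ≡-Reasoning

Contains-++ʳ : ∀ xs {ys d} → Contains ys d → Contains (xs ++ ys) d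
Contains-++ʳ xs {d = d} (pre , suf , eq) =
  xs ++ pre , suf , trans (++-assoc xs pre (d ++ suf)) (cong (xs ++_) eq)

ContainsPattern-++ˡ : ∀ {xs} ys → ContainsPattern xs → ContainsPattern (xs ++ ys)
ContainsPattern-++ˡ {xs} ys (d , p , occ) = d , p , Sum.map (Contains-++ˡ ys) inReverse occ
  where
  inReverse : Contains (reverse xs) d → Contains (reverse (xs ++ ys)) d
  inReverse c = subst (λ z → Contains z d) (sym (reverse-++ xs ys)) (Contains-++ʳ (reverse ys) c)

ContainsPattern-++ʳ : ∀ xs {ys} → ContainsPattern ys → ContainsPattern (xs ++ ys)
ContainsPattern-++ʳ xs {ys} (d , p , occ) = d , p , Sum.map (Contains-++ʳ xs) inReverse occ
  where
  inReverse : Contains (reverse ys) d → Contains (reverse (xs ++ ys)) d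
  inReverse c = subst (λ z → Contains z d) (sym (reverse-++ xs ys)) (Contains-++ˡ (reverse xs) c)

patterns : List (∃ Pattern)
patterns = (_ , p122) ∷ (_ , p123) ∷ (_ , p124) ∷ (_ , p213) ∷ (_ , p214)
         ∷ (_ , p215) ∷ (_ , p314) ∷ (_ , p315) ∷ (_ , p1313) ∷ []

exceptionals : List (∃ Exceptional)
exceptionals = (_ , e00) ∷ (_ , e111) ∷ (_ , e1212) ∷ (_ , e2121) ∷ (_ , e21312) ∷ []

Infix⇒Contains : ∀ {d xs} → Infix _≡_ d xs → Contains xs d
Infix⇒Contains i with MkView pre eq suf ← toView i rewrite Pointwise-≡⇒≡ eq = pre , suf , refl

findPattern : (xs : List ℕ) → Maybe (ContainsPattern xs)
findPattern xs = Maybe.map witness (dec⇒maybe (any? occurs? patterns))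
  where
  Occurs : ∃ Pattern → Set
  Occurs (d , _) = Infix _≡_ d xs ⊎ Infix _≡_ d (reverse xs)
  occurs? : (p : ∃ Pattern) → Dec (Occurs p)
  occurs? (d , _) = infix? _≟_ d xs ⊎-dec infix? _≟_ d (reverse xs)
  witness : Any Occurs patterns → ContainsPattern xs
  witness found with (d , p) , occ ← satisfied found = d , p , Sum.map Infix⇒Contains Infix⇒Contains occ

findExceptional : (c : List ℕ) → Maybe (Exceptional c)
findExceptional c = Maybe.map witness (dec⇒maybe (any? (λ (e , _) → ≡-dec _≟_ e c) exceptionals))
  where
  witness : Any (λ (e , _) → e ≡ c) exceptionals → Exceptional c
  witness found with (_ , ex) , refl ← satisfied found = ex

search : (c : List ℕ) → Maybe (ExceptionalOrPattern c)
search c = Maybe.map inj₁ (findExceptional c) <∣> Maybe.map inj₂ (findPattern (middle c))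

-- On a concrete list the implicit argument reduces to ⊤ exactly when the search succeeds.
byComputation : ∀ {c} {found : T (is-just (search c))} → ExceptionalOrPattern c
byComputation {c} {found} = to-witness-T (search c) found

glue-Exceptional : ∀ {l r} → Exceptional l → Exceptional r → ExceptionalOrPattern (glue l r)
glue-Exceptional e00    e00    = byComputation
glue-Exceptional e00    e111   = byComputation
glue-Exceptional e00    e1212  = byComputation
glue-Exceptional e00    e2121  = byComputation
glue-Exceptional e00    e21312 = byComputation
glue-Exceptional e111   e00    = byComputation
glue-Exceptional e111   e111   = byComputation
glue-Exceptional e111   e1212  = byComputation
glue-Exceptional e111   e2121  = byComputation
glue-Exceptional e111   e21312 = byComputation
glue-Exceptional e1212  e00    = byComputation
glue-Exceptional e1212  e111   = byComputation
glue-Exceptional e1212  e1212  = byComputation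
glue-Exceptional e1212  e2121  = byComputation
glue-Exceptional e1212  e21312 = byComputation
glue-Exceptional e2121  e00    = byComputation
glue-Exceptional e2121  e111   = byComputation
glue-Exceptional e2121  e1212  = byComputation
glue-Exceptional e2121  e2121  = byComputation
glue-Exceptional e2121  e21312 = byComputation
glue-Exceptional e21312 e00    = byComputation
glue-Exceptional e21312 e111   = byComputation
glue-Exceptional e21312 e1212  = byComputation
glue-Exceptional e21312 e2121  = byComputation
glue-Exceptional e21312 e21312 = byComputation

GlueGenerated⇒ExceptionalOrPattern : ∀ {c} → GlueGenerated c → ExceptionalOrPattern c
GlueGenerated⇒ExceptionalOrPattern edge = inj₁ e00
GlueGenerated⇒ExceptionalOrPattern (triangle gl gr)
  with a , b , ls , refl ← GlueGenerated-∷∷ gl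
  with c , d , rs , refl ← GlueGenerated-∷∷ gr
  with m , split ← middle-glue a b ls c d rs
  with GlueGenerated⇒ExceptionalOrPattern gl | GlueGenerated⇒ExceptionalOrPattern gr
... | inj₂ pl  | _        = inj₂ (subst ContainsPattern (sym split) (ContainsPattern-++ˡ _ pl))
... | inj₁ _   | inj₂ pr  = inj₂ (subst ContainsPattern (sym split) (ContainsPattern-++ʳ _ (ContainsPattern-++ʳ [ m ] pr)))
... | inj₁ exl | inj₁ exr = glue-Exceptional exl exr

theorem2p12 : (c : List ℕ) → IsQuiddity c →
    Exceptional c ⊎
    (∃[ d ] (Pattern d × (Contains (middle c) d ⊎ Contains (reverse (middle c)) d)))
theorem2p12 c q =
  GlueGenerated⇒ExceptionalOrPattern (EarGenerated⇒GlueGenerated (IsQuiddity⇒EarGenerated q))
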